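{- Let $\mathbf{L}$ be one of the logics described in the context, let $A$ be an arbitrary $\mathcal{L}^\lambda$-formula, $w$ a label, $y,z$ variables, and $\Gamma,\Delta$ arbitrary. Then the sequents (1) $w:A,\Gamma\Rightarrow\Delta,w:A$ and (2) $D(\iota yA,z,w),\Gamma\Rightarrow\Delta,D(\iota yA,z,w)$ are $\mathbf{G3Q\lambda.L}$-derivable.
   Context: Language $\mathcal{L}^\lambda$: fix a signature of $n$-ary predicate letters and an infinite set of variables $x,y,z,\dots$. Terms and formulas are defined simultaneously: terms $t::=x\mid \iota xA$ (definite descriptions), formulas $A::=Px_1\dots x_n\mid x_1=x_2\mid\bot\mid A\wedge A\mid A\vee A\mid A\supset A\mid\forall xA\mid\exists xA\mid\Box A\mid\Diamond A\mid \lambda xA.t$. $\iota x$ binds $x$ in $A$; in $\lambda xA.t$ the occurrences of $x$ in $A$ are bound by $\lambda x$ (the displayed $t$ is not in its scope). $A[y/x]$ replaces free occurrences of $x$ by $y$, with $y$ free for $x$. Atomic formulas are $Px_1\dots x_n$ and $x_1=x_2$. Labelled sequents. Labels $w,v,u,\dots$ form a separate set. Expressions: labelled formulas $w:A$, domain atoms $x\in w$, relational atoms $w\mathscr{R}v$, denotation formulas $D(t,x,w)$ ($t$ a term, $x$ a variable). A sequent $\Gamma\Rightarrow\Delta$ has $\Gamma$ a multiset of labelled formulas, denotation formulas, domain atoms and relational atoms, and $\Delta$ a multiset of labelled formulas and denotation formulas. Substitutions $[y/x]$, $[w/v]$ extend componentwise. "Fresh" means not occurring in the conclusion of the rule. Calculus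 $\mathbf{G3Q\lambda.K}$. Initial sequents: $w:p,\Gamma\Rightarrow\Delta,w:p$ ($p$ atomic); $D(y,x,w),\Gamma\Rightarrow\Delta,D(y,x,w)$ ($y$ a variable); $w:\bot,\Gamma\Rightarrow\Delta$. Propositional rules (at one label $w$): $L\wedge$: from $w:A,w:B,\Gamma\Rightarrow\Delta$ infer $w:A\wedge B,\Gamma\Rightarrow\Delta$; $R\wedge$: from $\Gamma\Rightarrow\Delta,w:A$ and $\Gamma\Rightarrow\Delta,w:B$ infer $\Gamma\Rightarrow\Delta,w:A\wedge B$; $L\vee$: from $w:A,\Gamma\Rightarrow\Delta$ and $w:B,\Gamma\Rightarrow\Delta$ infer $w:A\vee B,\Gamma\Rightarrow\Delta$; $R\vee$: from $\Gamma\Rightarrow\Delta,w:A,w:B$ infer $\Gamma\Rightarrow\Delta,w:A\vee B$; $L\supset$: from $\Gamma\Rightarrow\Delta,w:A$ and $w:B,\Gamma\Rightarrow\Delta$ infer $w:A\supset B,\Gamma\Rightarrow\Delta$; $R\supset$: from $w:A,\Gamma\Rightarrow\Delta,w:B$ infer $\Gamma\Rightarrow\Delta,w:A\supset B$. Quantifiers: $L\forall$: from $w:A[y/x],y\in w,w:\forall xA,\Gamma\Rightarrow\Delta$ infer $y\in w,w:\forall xA,\Gamma\Rightarrow\Delta$; $R\forall$ ($z$ fresh): from $z\in w,\Gamma\Rightarrow\Delta,w:A[z/x]$ infer $\Gamma\Rightarrow\Delta,w:\forall xA$; $L\exists$ ($z$ fresh): from $z\in w,w:A[z/x],\Gamma\Rightarrow\Delta$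 infer $w:\exists xA,\Gamma\Rightarrow\Delta$; $R\exists$: from $y\in w,\Gamma\Rightarrow\Delta,w:\exists xA,w:A[y/x]$ infer $y\in w,\Gamma\Rightarrow\Delta,w:\exists xA$. Modalities: $L\Box$: from $v:A,w\mathscr{R}v,w:\Box A,\Gamma\Rightarrow\Delta$ infer $w\mathscr{R}v,w:\Box A,\Gamma\Rightarrow\Delta$; $R\Box$ ($u$ fresh): from $w\mathscr{R}u,\Gamma\Rightarrow\Delta,u:A$ infer $\Gamma\Rightarrow\Delta,w:\Box A$; $L\Diamond$ ($u$ fresh): from $w\mathscr{R}u,u:A,\Gamma\Rightarrow\Delta$ infer $w:\Diamond A,\Gamma\Rightarrow\Delta$; $R\Diamond$: from $w\mathscr{R}v,\Gamma\Rightarrow\Delta,w:\Diamond A,v:A$ infer $w\mathscr{R}v,\Gamma\Rightarrow\Delta,w:\Diamond A$. Identity: $Ref_=$: from $w:x=x,\Gamma\Rightarrow\Delta$ infer $\Gamma\Rightarrow\Delta$; $RigVar$: from $v:y=z,w:y=z,\Gamma\Rightarrow\Delta$ infer $w:y=z,\Gamma\Rightarrow\Delta$; $Repl$: from $E[z/x],E[y/x],w:y=z,\Gamma\Rightarrow\Delta$ infer $E[y/x],w:y=z,\Gamma\Rightarrow\Delta$, where $E$ is a denotation formula with variable first argument and label $w$, a domain atom $x'\in w$, or a labelled atomic formula $w:p$. $\lambda$: $L\lambda$ ($z$ fresh): from $D(t,z,w),w:B[z/x],\Gamma\Rightarrow\Delta$ infer $w:\lambda xB.t,\Gamma\Rightarrow\Delta$;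 $R\lambda$: from $\Gamma\Rightarrow\Delta,w:\lambda xB.t,D(t,y,w)$ and $\Gamma\Rightarrow\Delta,w:\lambda xB.t,w:B[y/x]$ infer $\Gamma\Rightarrow\Delta,w:\lambda xB.t$. Denotation: $LD_1$: from $w:A[x_2/x_1],D(\iota x_1A,x_2,w),\Gamma\Rightarrow\Delta$ infer $D(\iota x_1A,x_2,w),\Gamma\Rightarrow\Delta$; $LD_2$: from $D(\iota x_1A,x_2,w),\Gamma\Rightarrow\Delta,w:A[y/x_1]$ and $w:x_2=y,D(\iota x_1A,x_2,w),\Gamma\Rightarrow\Delta$ infer $D(\iota x_1A,x_2,w),\Gamma\Rightarrow\Delta$; $RD$ ($z$ fresh): from $\Gamma\Rightarrow\Delta,w:A[x_2/x_1]$ and $w:A[z/x_1],\Gamma\Rightarrow\Delta,w:x_2=z$ infer $\Gamma\Rightarrow\Delta,D(\iota x_1A,x_2,w)$; $DenVar$: from $D(x,x,w),\Gamma\Rightarrow\Delta$ infer $\Gamma\Rightarrow\Delta$; $DenId$: from $w:y=x,D(y,x,w),\Gamma\Rightarrow\Delta$ infer $D(y,x,w),\Gamma\Rightarrow\Delta$ ($x,y$ variables). Non-logical rules: $Ref_\mathcal{W}$: from $w\mathscr{R}w,\Gamma\Rightarrow\Delta$ infer $\Gamma\Rightarrow\Delta$; $Ser$ ($u$ fresh): from $w\mathscr{R}u,\Gamma\Rightarrow\Delta$ infer $\Gamma\Rightarrow\Delta$; $Trans$: from $w\mathscr{R}u,w\mathscr{R}v,v\mathscr{R}u,\Gamma\Rightarrow\Delta$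 infer $w\mathscr{R}v,v\mathscr{R}u,\Gamma\Rightarrow\Delta$; $Eucl$: from $v\mathscr{R}u,w\mathscr{R}v,w\mathscr{R}u,\Gamma\Rightarrow\Delta$ infer $w\mathscr{R}v,w\mathscr{R}u,\Gamma\Rightarrow\Delta$, always together with $Eucl^c$: from $v\mathscr{R}v,w\mathscr{R}v,\Gamma\Rightarrow\Delta$ infer $w\mathscr{R}v,\Gamma\Rightarrow\Delta$; $Incr$: from $x\in v,x\in w,w\mathscr{R}v,\Gamma\Rightarrow\Delta$ infer $x\in w,w\mathscr{R}v,\Gamma\Rightarrow\Delta$; $Decr$: from $x\in w,x\in v,w\mathscr{R}v,\Gamma\Rightarrow\Delta$ infer $x\in v,w\mathscr{R}v,\Gamma\Rightarrow\Delta$; $Cons$: from $x\in w,\Gamma\Rightarrow\Delta$ infer $\Gamma\Rightarrow\Delta$. For any set $N$ of these non-logical rules, $\mathbf{G3Q\lambda.L}=\mathbf{G3Q\lambda.K}+N$. Derivations: trees of (pure: no variable both free and bound) sequents with initial sequents at the leaves, built by the rules; $\Gamma\Rightarrow\Delta$ is derivable if it or an alphabetic variant has a derivation. -}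

module Defs where

open import Data.Nat using (ℕ; _≟_)
open import Data.Bool using (if_then_else_)
open import Data.Product using (Σ; _×_; _,_)
open import Data.Sum using (_⊎_)
open import Data.Unit using (⊤)
open import Data.Empty using (⊥)
open import Data.Vec using (Vec)
import Data.Vec as Vec
open import Data.List using (List; []; _∷_; _++_; [_]; filter; concatMap)
open import Data.List.Membership.Propositional using (_∈_; _∉_)
open import Data.List.Relation.Unary.All using (All)
open import Data.List.Relation.Binary.Pointwise using (Pointwise)
open import Data.List.Relation.Binary.Permutation.Propositional using (_↭_)
open import Relation.Nullary using (¬_; ¬?)
open import Relation.Nullary.Decidable using (⌊_⌋)
open import Relation.Binary.PropositionalEquality using (_≡_; _≢_)

-- Variables and labels: two separate (infinite) sorts, both represented by ℕ.
Var : Set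
Var = ℕ

Label : Set
Label = ℕ

-- The non-logical rules that may be added to G3Qλ.K.
-- Selecting 'Eucl' adds both Eucl and Eucl^c (they always go together).
data NL : Set where
  RefW Ser Trans Eucl Incr Decr Cons : NL

module Lang (PS : Set) (ar : PS → ℕ) where

  mutual
    data Term : Set where
      var : Var → Term
      ι   : Var → Formula → Term

    data Formula : Set where
      pr   : (P : PS) → Vec Var (ar P) → Formula
      _≐_  : Var → Var → Formula
      ⊥'   : Formula
      _∧'_ _∨'_ _⊃_ : Formula → Formula → Formula
      ∀' ∃' : Var → Formula → Formula
      □ ◇  : Formula → Formula
      lam  : Var → Formula → Term → Formula   -- λ x B . t

  data Atomic : Formula → Set where
    atPr : ∀ P vs → Atomic (pr P vs)
    atEq : ∀ x y → Atomic (x ≐ y)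

  substV : Var → Var → Var → Var
  substV y x v = if ⌊ v ≟ x ⌋ then y else v

  mutual
    substT : Var → Var → Term → Term
    substT y x (var v) = var (substV y x v)
    substT y x (ι v A) = if ⌊ v ≟ x ⌋ then ι v A else ι v (substF y x A)

    substF : Var → Var → Formula → Formula
    substF y x (pr P vs) = pr P (Vec.map (substV y x) vs)
    substF y x (a ≐ b) = substV y x a ≐ substV y x b
    substF y x ⊥' = ⊥'
    substF y x (A ∧' B) = substF y x A ∧' substF y x B
    substF y x (A ∨' B) = substF y x A ∨' substF y x B
    substF y x (A ⊃ B) = substF y x A ⊃ substF y x B
    substF y x (∀' v A) = if ⌊ v ≟ x ⌋ then ∀' v A else ∀' v (substF y x A)
    substF y x (∃' v A) = if ⌊ v ≟ x ⌋ then ∃' v A else ∃' v (substF y x A)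
    substF y x (□ A) = □ (substF y x A)
    substF y x (◇ A) = ◇ (substF y x A)
    substF y x (lam v B t) =
      lam v (if ⌊ v ≟ x ⌋ then B else substF y x B) (substT y x t)

  _[_/_] : Formula → Var → Var → Formula
  A [ y / x ] = substF y x A

  remove : Var → List Var → List Var
  remove v xs = filter (λ u → ¬? (u ≟ v)) xs

  mutual
    fvT : Term → List Var
    fvT (var v) = [ v ]
    fvT (ι v A) = remove v (fvF A)

    fvF : Formula → List Var
    fvF (pr P vs) = Vec.toList vs
    fvF (a ≐ b) = a ∷ b ∷ []
    fvF ⊥' = []
    fvF (A ∧' B) = fvF A ++ fvF B
    fvF (A ∨' B) = fvF A ++ fvF B
    fvF (A ⊃ B) = fvF A ++ fvF B
    fvF (∀' v A) = remove v (fvF A)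
    fvF (∃' v A) = remove v (fvF A)
    fvF (□ A) = fvF A
    fvF (◇ A) = fvF A
    fvF (lam v B t) = remove v (fvF B) ++ fvT t

  mutual
    bvT : Term → List Var
    bvT (var v) = []
    bvT (ι v A) = v ∷ bvF A

    bvF : Formula → List Var
    bvF (pr P vs) = []
    bvF (a ≐ b) = []
    bvF ⊥' = []
    bvF (A ∧' B) = bvF A ++ bvF B
    bvF (A ∨' B) = bvF A ++ bvF B
    bvF (A ⊃ B) = bvF A ++ bvF B
    bvF (∀' v A) = v ∷ bvF A
    bvF (∃' v A) = v ∷ bvF A
    bvF (□ A) = bvF A
    bvF (◇ A) = bvF A
    bvF (lam v B t) = v ∷ bvF B ++ bvT t

  varsT : Term → List Var
  varsT t = fvT t ++ bvT t

  varsF : Formula → List Var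
  varsF A = fvF A ++ bvF A

  mutual
    FreeForT : Var → Var → Term → Set
    FreeForT y x (var v) = ⊤
    FreeForT y x (ι v A) = (x ∉ fvT (ι v A)) ⊎ (v ≢ y × FreeForF y x A)

    FreeForF : Var → Var → Formula → Set
    FreeForF y x (pr P vs) = ⊤
    FreeForF y x (a ≐ b) = ⊤
    FreeForF y x ⊥' = ⊤
    FreeForF y x (A ∧' B) = FreeForF y x A × FreeForF y x B
    FreeForF y x (A ∨' B) = FreeForF y x A × FreeForF y x B
    FreeForF y x (A ⊃ B) = FreeForF y x A × FreeForF y x B
    FreeForF y x (∀' v A) = (x ∉ fvF (∀' v A)) ⊎ (v ≢ y × FreeForF y x A)
    FreeForF y x (∃' v A) = (x ∉ fvF (∃' v A)) ⊎ (v ≢ y × FreeForF y x A)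
    FreeForF y x (□ A) = FreeForF y x A
    FreeForF y x (◇ A) = FreeForF y x A
    FreeForF y x (lam v B t) =
      ((x ∉ remove v (fvF B)) ⊎ (v ≢ y × FreeForF y x B)) × FreeForT y x t

  -- Sequent expressions
  -- SF: expressions allowed in the succedent (labelled / denotation formulas)
  data SF : Set where
    lab : Label → Formula → SF
    den : Term → Var → Label → SF           -- D(t, x, w)

  -- AF: expressions allowed in the antecedent
  data AF : Set where
    sf  : SF → AF
    dom : Var → Label → AF                  -- x ∈ w
    rel : Label → Label → AF                -- w R v

  -- Γ, Δ are multisets: lists, with a permutation rule in derivations.
  record Seq : Set where
    constructor _⇒_
    field
      ant : List AF
      suc : List SF

  infix 4 _⇒_

  fvSF : SF → List Var
  fvSF (lab w A) = fvF A
  fvSF (den t x w) = fvT t ++ [ x ]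

  bvSF : SF → List Var
  bvSF (lab w A) = bvF A
  bvSF (den t x w) = bvT t

  fvAF : AF → List Var
  fvAF (sf e) = fvSF e
  fvAF (dom x w) = [ x ]
  fvAF (rel w v) = []

  bvAF : AF → List Var
  bvAF (sf e) = bvSF e
  bvAF (dom x w) = []
  bvAF (rel w v) = []

  labSF : SF → List Label
  labSF (lab w A) = [ w ]
  labSF (den t x w) = [ w ]

  labAF : AF → List Label
  labAF (sf e) = labSF e
  labAF (dom x w) = [ w ]
  labAF (rel w v) = w ∷ v ∷ []

  fvS bvS : Seq → List Var
  fvS (Γ ⇒ Δ) = concatMap fvAF Γ ++ concatMap fvSF Δ
  bvS (Γ ⇒ Δ) = concatMap bvAF Γ ++ concatMap bvSF Δ

  varsS : Seq → List Var
  varsS S = fvS S ++ bvS S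

  labelsS : Seq → List Label
  labelsS (Γ ⇒ Δ) = concatMap labAF Γ ++ concatMap labSF Δ

  Pure : Seq → Set
  Pure S = ∀ v → v ∈ fvS S → v ∉ bvS S

  FreshVar : Var → Seq → Set
  FreshVar z S = z ∉ varsS S

  FreshLabel : Label → Seq → Set
  FreshLabel u S = u ∉ labelsS S

  substSF : Var → Var → SF → SF
  substSF y x (lab w A) = lab w (substF y x A)
  substSF y x (den t v w) = den (substT y x t) (substV y x v) w

  substAF : Var → Var → AF → AF
  substAF y x (sf e) = sf (substSF y x e)
  substAF y x (dom v w) = dom (substV y x v) w
  substAF y x (rel w v) = rel w v

  data ReplForm (w : Label) : AF → Set where
    rDen : ∀ a b → ReplForm w (sf (den (var a) b w))
    rDom : ∀ a → ReplForm w (dom a w)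
    rAt  : ∀ p → Atomic p → ReplForm w (sf (lab w p))

  data Rule (N : NL → Set) : List Seq → Seq → Set where
    perm : ∀ {Γ Γ' Δ Δ'} → Γ ↭ Γ' → Δ ↭ Δ' → Rule N [ Γ' ⇒ Δ' ] (Γ ⇒ Δ)
    initAt : ∀ {Γ Δ w p} → Atomic p →
      Rule N [] (sf (lab w p) ∷ Γ ⇒ lab w p ∷ Δ)
    initD : ∀ {Γ Δ y x w} →
      Rule N [] (sf (den (var y) x w) ∷ Γ ⇒ den (var y) x w ∷ Δ)
    init⊥ : ∀ {Γ Δ w} → Rule N [] (sf (lab w ⊥') ∷ Γ ⇒ Δ)
    L∧ : ∀ {Γ Δ w A B} →
      Rule N [ sf (lab w A) ∷ sf (lab w B) ∷ Γ ⇒ Δ ] (sf (lab w (A ∧' B)) ∷ Γ ⇒ Δ)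
    R∧ : ∀ {Γ Δ w A B} →
      Rule N ((Γ ⇒ lab w A ∷ Δ) ∷ (Γ ⇒ lab w B ∷ Δ) ∷ []) (Γ ⇒ lab w (A ∧' B) ∷ Δ)
    L∨ : ∀ {Γ Δ w A B} →
      Rule N ((sf (lab w A) ∷ Γ ⇒ Δ) ∷ (sf (lab w B) ∷ Γ ⇒ Δ) ∷ []) (sf (lab w (A ∨' B)) ∷ Γ ⇒ Δ)
    R∨ : ∀ {Γ Δ w A B} →
      Rule N [ Γ ⇒ lab w A ∷ lab w B ∷ Δ ] (Γ ⇒ lab w (A ∨' B) ∷ Δ)
    L⊃ : ∀ {Γ Δ w A B} →
      Rule N ((Γ ⇒ lab w A ∷ Δ) ∷ (sf (lab w B) ∷ Γ ⇒ Δ) ∷ []) (sf (lab w (A ⊃ B)) ∷ Γ ⇒ Δ)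
    R⊃ : ∀ {Γ Δ w A B} →
      Rule N [ sf (lab w A) ∷ Γ ⇒ lab w B ∷ Δ ] (Γ ⇒ lab w (A ⊃ B) ∷ Δ)
    L∀ : ∀ {Γ Δ w x y A} → FreeForF y x A →
      Rule N [ sf (lab w (A [ y / x ])) ∷ dom y w ∷ sf (lab w (∀' x A)) ∷ Γ ⇒ Δ ]
             (dom y w ∷ sf (lab w (∀' x A)) ∷ Γ ⇒ Δ)
    R∀ : ∀ {Γ Δ w x z A} → FreeForF z x A → FreshVar z (Γ ⇒ lab w (∀' x A) ∷ Δ) →
      Rule N [ dom z w ∷ Γ ⇒ lab w (A [ z / x ]) ∷ Δ ] (Γ ⇒ lab w (∀' x A) ∷ Δ)
    L∃ : ∀ {Γ Δ w x z A} → FreeForF z x A → FreshVar z (sf (lab w (∃' x A)) ∷ Γ ⇒ Δ) →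
      Rule N [ dom z w ∷ sf (lab w (A [ z / x ])) ∷ Γ ⇒ Δ ] (sf (lab w (∃' x A)) ∷ Γ ⇒ Δ)
    R∃ : ∀ {Γ Δ w x y A} → FreeForF y x A →
      Rule N [ dom y w ∷ Γ ⇒ lab w (∃' x A) ∷ lab w (A [ y / x ]) ∷ Δ ]
             (dom y w ∷ Γ ⇒ lab w (∃' x A) ∷ Δ)
    L□ : ∀ {Γ Δ w v A} →
      Rule N [ sf (lab v A) ∷ rel w v ∷ sf (lab w (□ A)) ∷ Γ ⇒ Δ ]
             (rel w v ∷ sf (lab w (□ A)) ∷ Γ ⇒ Δ)
    R□ : ∀ {Γ Δ w u A} → FreshLabel u (Γ ⇒ lab w (□ A) ∷ Δ) →
      Rule N [ rel w u ∷ Γ ⇒ lab u A ∷ Δ ] (Γ ⇒ lab w (□ A) ∷ Δ)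
    L◇ : ∀ {Γ Δ w u A} → FreshLabel u (sf (lab w (◇ A)) ∷ Γ ⇒ Δ) →
      Rule N [ rel w u ∷ sf (lab u A) ∷ Γ ⇒ Δ ] (sf (lab w (◇ A)) ∷ Γ ⇒ Δ)
    R◇ : ∀ {Γ Δ w v A} →
      Rule N [ rel w v ∷ Γ ⇒ lab w (◇ A) ∷ lab v A ∷ Δ ] (rel w v ∷ Γ ⇒ lab w (◇ A) ∷ Δ)
    Ref= : ∀ {Γ Δ w x} → Rule N [ sf (lab w (x ≐ x)) ∷ Γ ⇒ Δ ] (Γ ⇒ Δ)
    RigVar : ∀ {Γ Δ w v y z} →
      Rule N [ sf (lab v (y ≐ z)) ∷ sf (lab w (y ≐ z)) ∷ Γ ⇒ Δ ] (sf (lab w (y ≐ z)) ∷ Γ ⇒ Δ)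
    Repl : ∀ {Γ Δ w x y z E} → ReplForm w E →
      Rule N [ substAF z x E ∷ substAF y x E ∷ sf (lab w (y ≐ z)) ∷ Γ ⇒ Δ ]
             (substAF y x E ∷ sf (lab w (y ≐ z)) ∷ Γ ⇒ Δ)
    Lλ : ∀ {Γ Δ w x z B t} → FreeForF z x B → FreshVar z (sf (lab w (lam x B t)) ∷ Γ ⇒ Δ) →
      Rule N [ sf (den t z w) ∷ sf (lab w (B [ z / x ])) ∷ Γ ⇒ Δ ] (sf (lab w (lam x B t)) ∷ Γ ⇒ Δ)
    Rλ : ∀ {Γ Δ w x y B t} → FreeForF y x B →
      Rule N ((Γ ⇒ lab w (lam x B t) ∷ den t y w ∷ Δ) ∷
              (Γ ⇒ lab w (lam x B t) ∷ lab w (B [ y / x ]) ∷ Δ) ∷ [])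
             (Γ ⇒ lab w (lam x B t) ∷ Δ)
    LD₁ : ∀ {Γ Δ w x₁ x₂ A} → FreeForF x₂ x₁ A →
      Rule N [ sf (lab w (A [ x₂ / x₁ ])) ∷ sf (den (ι x₁ A) x₂ w) ∷ Γ ⇒ Δ ]
             (sf (den (ι x₁ A) x₂ w) ∷ Γ ⇒ Δ)
    LD₂ : ∀ {Γ Δ w x₁ x₂ y A} → FreeForF y x₁ A →
      Rule N ((sf (den (ι x₁ A) x₂ w) ∷ Γ ⇒ lab w (A [ y / x₁ ]) ∷ Δ) ∷
              (sf (lab w (x₂ ≐ y)) ∷ sf (den (ι x₁ A) x₂ w) ∷ Γ ⇒ Δ) ∷ [])
             (sf (den (ι x₁ A) x₂ w) ∷ Γ ⇒ Δ)
    RD : ∀ {Γ Δ w x₁ x₂ z A} → FreeForF x₂ x₁ A → FreeForF z x₁ A →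
      FreshVar z (Γ ⇒ den (ι x₁ A) x₂ w ∷ Δ) →
      Rule N ((Γ ⇒ lab w (A [ x₂ / x₁ ]) ∷ Δ) ∷
              (sf (lab w (A [ z / x₁ ])) ∷ Γ ⇒ lab w (x₂ ≐ z) ∷ Δ) ∷ [])
             (Γ ⇒ den (ι x₁ A) x₂ w ∷ Δ)
    DenVar : ∀ {Γ Δ w x} → Rule N [ sf (den (var x) x w) ∷ Γ ⇒ Δ ] (Γ ⇒ Δ)
    DenId : ∀ {Γ Δ w x y} →
      Rule N [ sf (lab w (y ≐ x)) ∷ sf (den (var y) x w) ∷ Γ ⇒ Δ ] (sf (den (var y) x w) ∷ Γ ⇒ Δ)
    RefWR : ∀ {Γ Δ w} → N RefW → Rule N [ rel w w ∷ Γ ⇒ Δ ] (Γ ⇒ Δ)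
    SerR : ∀ {Γ Δ w u} → N Ser → FreshLabel u (Γ ⇒ Δ) → Rule N [ rel w u ∷ Γ ⇒ Δ ] (Γ ⇒ Δ)
    TransR : ∀ {Γ Δ w v u} → N Trans →
      Rule N [ rel w u ∷ rel w v ∷ rel v u ∷ Γ ⇒ Δ ] (rel w v ∷ rel v u ∷ Γ ⇒ Δ)
    EuclR : ∀ {Γ Δ w v u} → N Eucl →
      Rule N [ rel v u ∷ rel w v ∷ rel w u ∷ Γ ⇒ Δ ] (rel w v ∷ rel w u ∷ Γ ⇒ Δ)
    EuclcR : ∀ {Γ Δ w v} → N Eucl →
      Rule N [ rel v v ∷ rel w v ∷ Γ ⇒ Δ ] (rel w v ∷ Γ ⇒ Δ)
    IncrR : ∀ {Γ Δ w v x} → N Incr →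
      Rule N [ dom x v ∷ dom x w ∷ rel w v ∷ Γ ⇒ Δ ] (dom x w ∷ rel w v ∷ Γ ⇒ Δ)
    DecrR : ∀ {Γ Δ w v x} → N Decr →
      Rule N [ dom x w ∷ dom x v ∷ rel w v ∷ Γ ⇒ Δ ] (dom x v ∷ rel w v ∷ Γ ⇒ Δ)
    ConsR : ∀ {Γ Δ w x} → N Cons → Rule N [ dom x w ∷ Γ ⇒ Δ ] (Γ ⇒ Δ)

  data Deriv (N : NL → Set) : Seq → Set where
    node : ∀ {ps c} → Rule N ps c → Pure c → All (Deriv N) ps → Deriv N c

  VarEq : List Var → List Var → Var → Var → Set
  VarEq [] [] x y = x ≡ y
  VarEq (a ∷ L) (b ∷ R) x y = (x ≡ a × y ≡ b) ⊎ ((x ≢ a) × (y ≢ b) × VarEq L R x y)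
  VarEq _ _ _ _ = ⊥

  mutual
    αT : List Var → List Var → Term → Term → Set
    αT L R (var a) (var b) = VarEq L R a b
    αT L R (ι a A) (ι b B) = αF (a ∷ L) (b ∷ R) A B
    αT L R _ _ = ⊥

    αF : List Var → List Var → Formula → Formula → Set
    αF L R (pr P vs) (pr Q us) =
      P ≡ Q × Pointwise (VarEq L R) (Vec.toList vs) (Vec.toList us)
    αF L R (a ≐ b) (c ≐ d) = VarEq L R a c × VarEq L R b d
    αF L R ⊥' ⊥' = ⊤
    αF L R (A ∧' B) (C ∧' D) = αF L R A C × αF L R B D
    αF L R (A ∨' B) (C ∨' D) = αF L R A C × αF L R B D
    αF L R (A ⊃ B) (C ⊃ D) = αF L R A C × αF L R B D
    αF L R (∀' a A) (∀' b B) = αF (a ∷ L) (b ∷ R) A B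
    αF L R (∃' a A) (∃' b B) = αF (a ∷ L) (b ∷ R) A B
    αF L R (□ A) (□ B) = αF L R A B
    αF L R (◇ A) (◇ B) = αF L R A B
    αF L R (lam a A s) (lam b B t) = αF (a ∷ L) (b ∷ R) A B × αT L R s t
    αF L R _ _ = ⊥

  αSF : SF → SF → Set
  αSF (lab w A) (lab v B) = w ≡ v × αF [] [] A B
  αSF (den t x w) (den s y v) = αT [] [] t s × x ≡ y × w ≡ v
  αSF _ _ = ⊥

  αAF : AF → AF → Set
  αAF (sf e) (sf f) = αSF e f
  αAF (dom x w) (dom y v) = x ≡ y × w ≡ v
  αAF (rel w v) (rel w' v') = w ≡ w' × v ≡ v'
  αAF _ _ = ⊥

  AlphaVariant : Seq → Seq → Set
  AlphaVariant (Γ ⇒ Δ) (Γ' ⇒ Δ') = Pointwise αAF Γ Γ' × Pointwise αSF Δ Δ'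

  Derivable : (N : NL → Set) → Seq → Set
  Derivable N S = Σ Seq (λ S' → AlphaVariant S S' × Deriv N S')

module Submission where

-- The argument is the usual simultaneous induction on formulas
-- (w:A ⇒ w:A) and terms (D(t,z,w) ⇒ D(t,z,w)), using only logical rules;
-- the ι case applies RD, LD₁ and LD₂.  Three points need care here.
-- (1) The quantifier, λ and ι cases recurse into an instance A[z/x] of a
--     body, so the induction is on the shape of A, preserved by substitution.
-- (2) Derivations consist of pure sequents.  We keep the stronger,
--     item-wise invariant that a fixed list B separates free from bound
--     variables (free ∉ B, bound ∈ B): eigenvariables are chosen outside B,
--     and substituting them for a bound variable preserves separation.
-- (3) Γ, Δ are arbitrary and may be impure, so we derive the canonical
--     alphabetic variant, which renames all bound variables above every
--     variable of the sequent; it is pure, hence separated by its own bound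
--     variables.

open import Defs
open import Data.Nat using (ℕ; suc; s≤s; _+_; _≤_; _<_; _≟_)
open import Data.Nat.Properties using (≤∧≢⇒<; <⇒≱; <⇒≢; m<1+n⇒m≤n; m<n⇒m<1+n; n<1+n; m≤n+m)
open import Data.Bool using (if_then_else_)
open import Data.Product using (_×_; _,_; proj₁; proj₂)
import Data.Product as Product
open import Data.Sum using (_⊎_; inj₁; inj₂; [_,_]′)
import Data.Sum as Sum
open import Data.Unit using (tt)
open import Function using (_∘_)
open import Data.Vec using (Vec)
import Data.Vec as Vec
open import Data.Vec.Properties using (toList-map)
open import Data.List using (List; []; _∷_; _++_; [_]; map; concatMap; length)
open import Data.List.Extrema.Nat using (max; xs≤max)
open import Data.List.Relation.Binary.Pointwise using (Pointwise; []; _∷_)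
open import Data.List.Relation.Binary.Permutation.Propositional using (_↭_; ↭-refl; swap)
open import Data.List.Relation.Unary.Any using (here; there)
open import Data.List.Relation.Unary.All using (All; []; _∷_)
import Data.List.Relation.Unary.All as All
open import Data.List.Relation.Unary.All.Properties using (++⁺; ++⁻ˡ; ++⁻ʳ; concat⁺; concat⁻; map⁺; map⁻)
open import Data.List.Membership.Propositional using (_∈_; _∉_)
open import Data.List.Membership.Propositional.Properties using (∈-++⁺ˡ; ∈-++⁺ʳ; ∈-++⁻; ∈-filter⁺; ∈-filter⁻; ∈-map⁻)
open import Relation.Nullary using (yes; no; ¬?)
open import Relation.Nullary.Decidable using (⌊_⌋)
open import Relation.Binary.PropositionalEquality using (_≡_; _≢_; refl; sym; cong; cong₂; subst)

above : List ℕ → ℕ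
above xs = suc (max 0 xs)

<above : ∀ xs → All (_< above xs) xs
<above xs = All.map s≤s (xs≤max 0 xs)

above∉ : ∀ xs → above xs ∉ xs
above∉ xs m = <⇒≢ (All.lookup (<above xs) m) refl

concatMap⁺ : ∀ {A B : Set} {P : B → Set} {f : A → List B} {xs} →
             All (λ x → All P (f x)) xs → All P (concatMap f xs)
concatMap⁺ ps = concat⁺ (map⁺ ps)

concatMap⁻ : ∀ {A B : Set} {P : B → Set} {f : A → List B} xs →
             All P (concatMap f xs) → All (λ x → All P (f x)) xs
concatMap⁻ xs ps = map⁻ (concat⁻ ps)

pointwise-map : ∀ {X : Set} {P : X → Set} {R : X → X → Set} {f : X → X} xs →
                (∀ x → P x → R x (f x)) → All P xs → Pointwise R xs (map f xs)
pointwise-map []       r []         = []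
pointwise-map (x ∷ xs) r (px ∷ pxs) = r x px ∷ pointwise-map xs r pxs

swap₂ : ∀ {X : Set} {a b : X} {xs} → a ∷ b ∷ xs ↭ b ∷ a ∷ xs
swap₂ = swap _ _ ↭-refl

module GeneralisedIdentity {PS : Set} (ar : PS → ℕ) where
  open Lang PS ar

  ∈-remove⁻ : ∀ {u v} xs → u ∈ remove v xs → u ∈ xs × u ≢ v
  ∈-remove⁻ {v = v} xs = ∈-filter⁻ (λ a → ¬? (a ≟ v)) {xs = xs}

  ∈-remove⁺ : ∀ {u v} xs → u ∈ xs → u ≢ v → u ∈ remove v xs
  ∈-remove⁺ {v = v} xs = ∈-filter⁺ (λ a → ¬? (a ≟ v)) {xs = xs}

  data Shape : Set where
    leaf   : Shape
    unary  : Shape → Shape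
    binary : Shape → Shape → Shape

  mutual
    shapeF : Formula → Shape
    shapeF (pr P vs)   = leaf
    shapeF (a ≐ b)     = leaf
    shapeF ⊥'          = leaf
    shapeF (A ∧' B)    = binary (shapeF A) (shapeF B)
    shapeF (A ∨' B)    = binary (shapeF A) (shapeF B)
    shapeF (A ⊃ B)     = binary (shapeF A) (shapeF B)
    shapeF (∀' v A)    = unary (shapeF A)
    shapeF (∃' v A)    = unary (shapeF A)
    shapeF (□ A)       = unary (shapeF A)
    shapeF (◇ A)       = unary (shapeF A)
    shapeF (lam v B t) = binary (shapeF B) (shapeT t)

    shapeT : Term → Shape
    shapeT (var v) = leaf
    shapeT (ι v A) = unary (shapeF A)

  -- Substitution of a variable preserves the shape; this is what makes the
  -- identity derivations below terminate (they recurse into A[z/x]).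
  mutual
    shape-subst : ∀ y x A → shapeF (A [ y / x ]) ≡ shapeF A
    shape-subst y x (pr P vs) = refl
    shape-subst y x (a ≐ b)   = refl
    shape-subst y x ⊥'        = refl
    shape-subst y x (A ∧' B)  = cong₂ binary (shape-subst y x A) (shape-subst y x B)
    shape-subst y x (A ∨' B)  = cong₂ binary (shape-subst y x A) (shape-subst y x B)
    shape-subst y x (A ⊃ B)   = cong₂ binary (shape-subst y x A) (shape-subst y x B)
    shape-subst y x (∀' v A) with v ≟ x
    ... | yes _ = refl
    ... | no  _ = cong unary (shape-subst y x A)
    shape-subst y x (∃' v A) with v ≟ x
    ... | yes _ = refl
    ... | no  _ = cong unary (shape-subst y x A)
    shape-subst y x (□ A)     = cong unary (shape-subst y x A)
    shape-subst y x (◇ A)     = cong unary (shape-subst y x A)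
    shape-subst y x (lam v B t) with v ≟ x
    ... | yes _ = cong (binary (shapeF B)) (shapeT-subst y x t)
    ... | no  _ = cong₂ binary (shape-subst y x B) (shapeT-subst y x t)

    shapeT-subst : ∀ y x t → shapeT (substT y x t) ≡ shapeT t
    shapeT-subst y x (var v) = refl
    shapeT-subst y x (ι v A) with v ≟ x
    ... | yes _ = refl
    ... | no  _ = cong unary (shape-subst y x A)

  mutual
    bv-subst : ∀ y x A → bvF (A [ y / x ]) ≡ bvF A
    bv-subst y x (pr P vs) = refl
    bv-subst y x (a ≐ b)   = refl
    bv-subst y x ⊥'        = refl
    bv-subst y x (A ∧' B)  = cong₂ _++_ (bv-subst y x A) (bv-subst y x B)
    bv-subst y x (A ∨' B)  = cong₂ _++_ (bv-subst y x A) (bv-subst y x B)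
    bv-subst y x (A ⊃ B)   = cong₂ _++_ (bv-subst y x A) (bv-subst y x B)
    bv-subst y x (∀' v A) with v ≟ x
    ... | yes _ = refl
    ... | no  _ = cong (v ∷_) (bv-subst y x A)
    bv-subst y x (∃' v A) with v ≟ x
    ... | yes _ = refl
    ... | no  _ = cong (v ∷_) (bv-subst y x A)
    bv-subst y x (□ A)     = bv-subst y x A
    bv-subst y x (◇ A)     = bv-subst y x A
    bv-subst y x (lam v B t) with v ≟ x
    ... | yes _ = cong (λ bs → v ∷ bvF B ++ bs) (bvT-subst y x t)
    ... | no  _ = cong₂ (λ bs cs → v ∷ bs ++ cs) (bv-subst y x B) (bvT-subst y x t)

    bvT-subst : ∀ y x t → bvT (substT y x t) ≡ bvT t
    bvT-subst y x (var v) = refl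
    bvT-subst y x (ι v A) with v ≟ x
    ... | yes _ = refl
    ... | no  _ = cong (v ∷_) (bv-subst y x A)

  SubstFV : Var → Var → List Var → Var → Set
  SubstFV y x L u = u ≡ y ⊎ (u ≢ x × u ∈ L)

  module _ (y x : Var) where

    sfv-++ˡ : ∀ {L M u} → SubstFV y x L u → SubstFV y x (L ++ M) u
    sfv-++ˡ = Sum.map₂ (Product.map₂ ∈-++⁺ˡ)

    sfv-++ʳ : ∀ L {M u} → SubstFV y x M u → SubstFV y x (L ++ M) u
    sfv-++ʳ L = Sum.map₂ (Product.map₂ (∈-++⁺ʳ L))

    fv-substV : ∀ L {u} → u ∈ map (substV y x) L → SubstFV y x L u
    fv-substV L m with ∈-map⁻ (substV y x) m
    ... | a , a∈L , refl with a ≟ x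
    ...   | yes _   = inj₁ refl
    ...   | no  a≢x = inj₂ (a≢x , a∈L)

    fv-substVec : ∀ {n} (vs : Vec Var n) {u} →
                  u ∈ Vec.toList (Vec.map (substV y x) vs) → SubstFV y x (Vec.toList vs) u
    fv-substVec vs m rewrite toList-map (substV y x) vs = fv-substV (Vec.toList vs) m

    -- the binder v = x shadows x: nothing is substituted below it
    fv-shadowed : ∀ v L {u} → v ≡ x → u ∈ remove v L → SubstFV y x (remove v L) u
    fv-shadowed v L refl m = inj₂ (proj₂ (∈-remove⁻ L m) , m)

    mutual
      fv-subst : ∀ A {u} → u ∈ fvF (A [ y / x ]) → SubstFV y x (fvF A) u
      fv-subst (pr P vs) m = fv-substVec vs m
      fv-subst (a ≐ b) m   = fv-substV (a ∷ b ∷ []) m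
      fv-subst ⊥' ()
      fv-subst (A ∧' B) m  = fv-subst₂ A B m
      fv-subst (A ∨' B) m  = fv-subst₂ A B m
      fv-subst (A ⊃ B) m   = fv-subst₂ A B m
      fv-subst (∀' v A) m with v ≟ x
      ... | yes v≡x = fv-shadowed v (fvF A) v≡x m
      ... | no  _   = fv-under v A m
      fv-subst (∃' v A) m with v ≟ x
      ... | yes v≡x = fv-shadowed v (fvF A) v≡x m
      ... | no  _   = fv-under v A m
      fv-subst (□ A) m     = fv-subst A m
      fv-subst (◇ A) m     = fv-subst A m
      fv-subst (lam v B t) m with v ≟ x
      ... | yes v≡x = [ sfv-++ˡ ∘ fv-shadowed v (fvF B) v≡x , sfv-++ʳ _ ∘ fv-substT t ]′ (∈-++⁻ _ m)
      ... | no  _   = [ sfv-++ˡ ∘ fv-under v B , sfv-++ʳ _ ∘ fv-substT t ]′ (∈-++⁻ _ m)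

      fv-substT : ∀ t {u} → u ∈ fvT (substT y x t) → SubstFV y x (fvT t) u
      fv-substT (var a) m = fv-substV [ a ] m
      fv-substT (ι v A) m with v ≟ x
      ... | yes v≡x = fv-shadowed v (fvF A) v≡x m
      ... | no  _   = fv-under v A m

      fv-subst₂ : ∀ A B {u} → u ∈ fvF (A [ y / x ]) ++ fvF (B [ y / x ]) →
                  SubstFV y x (fvF A ++ fvF B) u
      fv-subst₂ A B m = [ sfv-++ˡ ∘ fv-subst A , sfv-++ʳ _ ∘ fv-subst B ]′ (∈-++⁻ _ m)

      fv-under : ∀ v A {u} → u ∈ remove v (fvF (A [ y / x ])) → SubstFV y x (remove v (fvF A)) u
      fv-under v A m with ∈-remove⁻ (fvF (A [ y / x ])) m
      ... | m′ , u≢v with fv-subst A m′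
      ...   | inj₁ u≡y         = inj₁ u≡y
      ...   | inj₂ (u≢x , u∈A) = inj₂ (u≢x , ∈-remove⁺ (fvF A) u∈A u≢v)

  mutual
    unbound⇒freeFor : ∀ {y x} A → y ∉ bvF A → FreeForF y x A
    unbound⇒freeFor (pr P vs) y∉ = tt
    unbound⇒freeFor (a ≐ b) y∉   = tt
    unbound⇒freeFor ⊥' y∉        = tt
    unbound⇒freeFor (A ∧' B) y∉  = unbound⇒freeFor₂ A B y∉
    unbound⇒freeFor (A ∨' B) y∉  = unbound⇒freeFor₂ A B y∉
    unbound⇒freeFor (A ⊃ B) y∉   = unbound⇒freeFor₂ A B y∉
    unbound⇒freeFor (∀' v A) y∉  = inj₂ (y∉ ∘ here ∘ sym , unbound⇒freeFor A (y∉ ∘ there))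
    unbound⇒freeFor (∃' v A) y∉  = inj₂ (y∉ ∘ here ∘ sym , unbound⇒freeFor A (y∉ ∘ there))
    unbound⇒freeFor (□ A) y∉     = unbound⇒freeFor A y∉
    unbound⇒freeFor (◇ A) y∉     = unbound⇒freeFor A y∉
    unbound⇒freeFor (lam v B t) y∉ =
        inj₂ (y∉ ∘ here ∘ sym , unbound⇒freeFor B (y∉ ∘ there ∘ ∈-++⁺ˡ))
      , unbound⇒freeForT t (y∉ ∘ there ∘ ∈-++⁺ʳ (bvF B))

    unbound⇒freeForT : ∀ {y x} t → y ∉ bvT t → FreeForT y x t
    unbound⇒freeForT (var v) y∉ = tt
    unbound⇒freeForT (ι v A) y∉ = inj₂ (y∉ ∘ here ∘ sym , unbound⇒freeFor A (y∉ ∘ there))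

    unbound⇒freeFor₂ : ∀ {y x} A B → y ∉ bvF A ++ bvF B → FreeForF y x A × FreeForF y x B
    unbound⇒freeFor₂ A B y∉ =
      unbound⇒freeFor A (y∉ ∘ ∈-++⁺ˡ) , unbound⇒freeFor B (y∉ ∘ ∈-++⁺ʳ (bvF A))

  -- A sequent
  -- all of whose items are separated by the same B is pure, and it stays
  -- so when the identity derivations below decompose formulas and
  -- introduce variables outside B.
  Sep : List Var → List Var → List Var → Set
  Sep B fv bv = All (_∉ B) fv × All (_∈ B) bv

  SepF : List Var → Formula → Set
  SepF B A = Sep B (fvF A) (bvF A)

  SepS : List Var → SF → Set
  SepS B e = Sep B (fvSF e) (bvSF e)

  SepA : List Var → AF → Set
  SepA B a = Sep B (fvAF a) (bvAF a)

  Separated : List Var → Seq → Set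
  Separated B (Γ ⇒ Δ) = All (SepA B) Γ × All (SepS B) Δ

  separated⇒pure : ∀ B S → Separated B S → Pure S
  separated⇒pure B (Γ ⇒ Δ) (sΓ , sΔ) v v∈fv v∈bv = All.lookup free v∈fv (All.lookup bound v∈bv)
    where
    free : All (_∉ B) (fvS (Γ ⇒ Δ))
    free = ++⁺ (concatMap⁺ (All.map proj₁ sΓ)) (concatMap⁺ (All.map proj₁ sΔ))
    bound : All (_∈ B) (bvS (Γ ⇒ Δ))
    bound = ++⁺ (concatMap⁺ (All.map proj₂ sΓ)) (concatMap⁺ (All.map proj₂ sΔ))

  pure⇒separated : ∀ S → Pure S → Separated (bvS S) S
  pure⇒separated (Γ ⇒ Δ) pure =
    All.zip (concatMap⁻ Γ freeΓ , concatMap⁻ Γ boundΓ) , All.zip (concatMap⁻ Δ freeΔ , concatMap⁻ Δ boundΔ)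
    where
    B : List Var
    B = bvS (Γ ⇒ Δ)
    free : All (_∉ B) (fvS (Γ ⇒ Δ))
    free = All.tabulate (pure _)
    freeΓ : All (_∉ B) (concatMap fvAF Γ)
    freeΓ = ++⁻ˡ (concatMap fvAF Γ) free
    freeΔ : All (_∉ B) (concatMap fvSF Δ)
    freeΔ = ++⁻ʳ (concatMap fvAF Γ) free
    bound : All (_∈ B) B
    bound = All.tabulate (λ m → m)
    boundΓ : All (_∈ B) (concatMap bvAF Γ)
    boundΓ = ++⁻ˡ (concatMap bvAF Γ) bound
    boundΔ : All (_∈ B) (concatMap bvSF Δ)
    boundΔ = ++⁻ʳ (concatMap bvAF Γ) bound

  module _ {B : List Var} where

    sep-++ˡ : ∀ fv₁ bv₁ {fv₂ bv₂} → Sep B (fv₁ ++ fv₂) (bv₁ ++ bv₂) → Sep B fv₁ bv₁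
    sep-++ˡ fv₁ bv₁ = Product.map (++⁻ˡ fv₁) (++⁻ˡ bv₁)

    sep-++ʳ : ∀ fv₁ bv₁ {fv₂ bv₂} → Sep B (fv₁ ++ fv₂) (bv₁ ++ bv₂) → Sep B fv₂ bv₂
    sep-++ʳ fv₁ bv₁ = Product.map (++⁻ʳ fv₁) (++⁻ʳ bv₁)

    sep-body : ∀ {fv x bv} → Sep B fv (x ∷ bv) → Sep B fv bv
    sep-body = Product.map₂ All.tail

    module _ {z x : Var} (A : Formula) (z∉B : z ∉ B)
             (sA : Sep B (remove x (fvF A)) (bvF A)) where

      sep-freeFor : FreeForF z x A
      sep-freeFor = unbound⇒freeFor A (z∉B ∘ All.lookup (proj₂ sA))

      sep-subst : SepF B (A [ z / x ])
      sep-subst = All.tabulate free , subst (All (_∈ B)) (sym (bv-subst z x A)) (proj₂ sA)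
        where
        free : ∀ {u} → u ∈ fvF (A [ z / x ]) → u ∉ B
        free m with fv-subst z x A m
        ... | inj₁ refl           = z∉B
        ... | inj₂ (u≢x , u∈fvA) = All.lookup (proj₁ sA) (∈-remove⁺ (fvF A) u∈fvA u≢x)

  module Identities (N : NL → Set) (B : List Var) where

    infer : ∀ {ps Γ Δ} → Rule N ps (Γ ⇒ Δ) → All (SepA B) Γ → All (SepS B) Δ →
            All (Deriv N) ps → Deriv N (Γ ⇒ Δ)
    infer {Γ = Γ} {Δ} r sΓ sΔ = node r (separated⇒pure B (Γ ⇒ Δ) (sΓ , sΔ))

    freshVar : Seq → Var
    freshVar S = above (B ++ varsS S)

    freshVar∉B : ∀ S → freshVar S ∉ B
    freshVar∉B S = above∉ (B ++ varsS S) ∘ ∈-++⁺ˡ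

    freshVar-fresh : ∀ S → FreshVar (freshVar S) S
    freshVar-fresh S = above∉ (B ++ varsS S) ∘ ∈-++⁺ʳ B

    freshLabel-fresh : ∀ S → FreshLabel (above (labelsS S)) S
    freshLabel-fresh S = above∉ (labelsS S)

    sepRel : ∀ w v → SepA B (rel w v)
    sepRel w v = [] , []

    sepDom : ∀ {z} w → z ∉ B → SepA B (dom z w)
    sepDom w z∉B = z∉B ∷ [] , []

    mutual
      identityF : ∀ s A → shapeF A ≡ s → ∀ {w Γ Δ} → SepF B A →
                  All (SepA B) Γ → All (SepS B) Δ → Deriv N (sf (lab w A) ∷ Γ ⇒ lab w A ∷ Δ)
      identityF _ (pr P vs) _ s sΓ sΔ = infer (initAt (atPr P vs)) (s ∷ sΓ) (s ∷ sΔ) []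
      identityF _ (a ≐ b) _ s sΓ sΔ   = infer (initAt (atEq a b)) (s ∷ sΓ) (s ∷ sΔ) []
      identityF _ ⊥' _ s sΓ sΔ        = infer init⊥ (s ∷ sΓ) (s ∷ sΔ) []
      identityF _ (A ∧' C) refl s sΓ sΔ =
        infer R∧ (s ∷ sΓ) (s ∷ sΔ)
          ( infer L∧ (s ∷ sΓ) (sA ∷ sΔ) (identityF _ A refl sA (sC ∷ sΓ) sΔ ∷ [])
          ∷ infer L∧ (s ∷ sΓ) (sC ∷ sΔ)
              ( infer (perm swap₂ ↭-refl) (sA ∷ sC ∷ sΓ) (sC ∷ sΔ)
                  (identityF _ C refl sC (sA ∷ sΓ) sΔ ∷ [])
              ∷ [])
          ∷ [])
        where
        sA : SepF B A
        sA = sep-++ˡ (fvF A) (bvF A) s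
        sC : SepF B C
        sC = sep-++ʳ (fvF A) (bvF A) s
      identityF _ (A ∨' C) refl s sΓ sΔ =
        infer L∨ (s ∷ sΓ) (s ∷ sΔ)
          ( infer R∨ (sA ∷ sΓ) (s ∷ sΔ) (identityF _ A refl sA sΓ (sC ∷ sΔ) ∷ [])
          ∷ infer R∨ (sC ∷ sΓ) (s ∷ sΔ)
              ( infer (perm ↭-refl swap₂) (sC ∷ sΓ) (sA ∷ sC ∷ sΔ)
                  (identityF _ C refl sC sΓ (sA ∷ sΔ) ∷ [])
              ∷ [])
          ∷ [])
        where
        sA : SepF B A
        sA = sep-++ˡ (fvF A) (bvF A) s
        sC : SepF B C
        sC = sep-++ʳ (fvF A) (bvF A) s
      identityF _ (A ⊃ C) refl s sΓ sΔ =
        infer R⊃ (s ∷ sΓ) (s ∷ sΔ)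
          ( infer (perm swap₂ ↭-refl) (sA ∷ s ∷ sΓ) (sC ∷ sΔ)
              ( infer L⊃ (s ∷ sA ∷ sΓ) (sC ∷ sΔ)
                  ( identityF _ A refl sA sΓ (sC ∷ sΔ)
                  ∷ identityF _ C refl sC (sA ∷ sΓ) sΔ
                  ∷ [])
              ∷ [])
          ∷ [])
        where
        sA : SepF B A
        sA = sep-++ˡ (fvF A) (bvF A) s
        sC : SepF B C
        sC = sep-++ʳ (fvF A) (bvF A) s
      identityF _ (□ A) refl {w} {Γ} {Δ} s sΓ sΔ =
        infer (R□ (freshLabel-fresh S)) (s ∷ sΓ) (s ∷ sΔ)
          ( infer L□ (sepRel w u ∷ s ∷ sΓ) (s ∷ sΔ)
              (identityF _ A refl s (sepRel w u ∷ s ∷ sΓ) sΔ ∷ [])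
          ∷ [])
        where
        S : Seq
        S = sf (lab w (□ A)) ∷ Γ ⇒ lab w (□ A) ∷ Δ
        u : Label
        u = above (labelsS S)
      identityF _ (◇ A) refl {w} {Γ} {Δ} s sΓ sΔ =
        infer (L◇ (freshLabel-fresh S)) (s ∷ sΓ) (s ∷ sΔ)
          ( infer R◇ (sepRel w u ∷ s ∷ sΓ) (s ∷ sΔ)
              ( infer (perm swap₂ swap₂) (sepRel w u ∷ s ∷ sΓ) (s ∷ s ∷ sΔ)
                  (identityF _ A refl s (sepRel w u ∷ sΓ) (s ∷ sΔ) ∷ [])
              ∷ [])
          ∷ [])
        where
        S : Seq
        S = sf (lab w (◇ A)) ∷ Γ ⇒ lab w (◇ A) ∷ Δ
        u : Label
        u = above (labelsS S)
      identityF _ (∀' x A) refl {w} {Γ} {Δ} s sΓ sΔ =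
        infer (R∀ ff (freshVar-fresh S)) (s ∷ sΓ) (s ∷ sΔ)
          ( infer (L∀ ff) (sepDom w z∉B ∷ s ∷ sΓ) (sAz ∷ sΔ)
              (identityF _ (A [ z / x ]) (shape-subst z x A) sAz (sepDom w z∉B ∷ s ∷ sΓ) sΔ ∷ [])
          ∷ [])
        where
        S : Seq
        S = sf (lab w (∀' x A)) ∷ Γ ⇒ lab w (∀' x A) ∷ Δ
        z : Var
        z = freshVar S
        z∉B : z ∉ B
        z∉B = freshVar∉B S
        ff : FreeForF z x A
        ff = sep-freeFor A z∉B (sep-body s)
        sAz : SepF B (A [ z / x ])
        sAz = sep-subst A z∉B (sep-body s)
      identityF _ (∃' x A) refl {w} {Γ} {Δ} s sΓ sΔ =
        infer (L∃ ff (freshVar-fresh S)) (s ∷ sΓ) (s ∷ sΔ)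
          ( infer (R∃ ff) (sepDom w z∉B ∷ sAz ∷ sΓ) (s ∷ sΔ)
              ( infer (perm swap₂ swap₂) (sepDom w z∉B ∷ sAz ∷ sΓ) (s ∷ sAz ∷ sΔ)
                  (identityF _ (A [ z / x ]) (shape-subst z x A) sAz (sepDom w z∉B ∷ sΓ) (s ∷ sΔ) ∷ [])
              ∷ [])
          ∷ [])
        where
        S : Seq
        S = sf (lab w (∃' x A)) ∷ Γ ⇒ lab w (∃' x A) ∷ Δ
        z : Var
        z = freshVar S
        z∉B : z ∉ B
        z∉B = freshVar∉B S
        ff : FreeForF z x A
        ff = sep-freeFor A z∉B (sep-body s)
        sAz : SepF B (A [ z / x ])
        sAz = sep-subst A z∉B (sep-body s)
      identityF _ (lam x A t) refl {w} {Γ} {Δ} s sΓ sΔ =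
        infer (Lλ ff (freshVar-fresh S)) (s ∷ sΓ) (s ∷ sΔ)
          ( infer (Rλ ff) (sDen ∷ sAz ∷ sΓ) (s ∷ sΔ)
              ( infer (perm ↭-refl swap₂) (sDen ∷ sAz ∷ sΓ) (s ∷ sDen ∷ sΔ)
                  (identityT _ t refl sDen (sAz ∷ sΓ) (s ∷ sΔ) ∷ [])
              ∷ infer (perm swap₂ swap₂) (sDen ∷ sAz ∷ sΓ) (s ∷ sAz ∷ sΔ)
                  (identityF _ (A [ z / x ]) (shape-subst z x A) sAz (sDen ∷ sΓ) (s ∷ sΔ) ∷ [])
              ∷ [])
          ∷ [])
        where
        S : Seq
        S = sf (lab w (lam x A t)) ∷ Γ ⇒ lab w (lam x A t) ∷ Δ
        z : Var
        z = freshVar S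
        z∉B : z ∉ B
        z∉B = freshVar∉B S
        sBody : Sep B (remove x (fvF A)) (bvF A)
        sBody = sep-++ˡ (remove x (fvF A)) (bvF A) (sep-body s)
        ff : FreeForF z x A
        ff = sep-freeFor A z∉B sBody
        sAz : SepF B (A [ z / x ])
        sAz = sep-subst A z∉B sBody
        sDen : SepS B (den t z w)
        sDen = Product.map₁ (λ free → ++⁺ free (z∉B ∷ []))
                            (sep-++ʳ (remove x (fvF A)) (bvF A) (sep-body s))

      identityT : ∀ s t → shapeT t ≡ s → ∀ {z w Γ Δ} → SepS B (den t z w) →
                  All (SepA B) Γ → All (SepS B) Δ → Deriv N (sf (den t z w) ∷ Γ ⇒ den t z w ∷ Δ)
      identityT _ (var v) _ s sΓ sΔ = infer initD (s ∷ sΓ) (s ∷ sΔ) []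
      identityT _ (ι y A) refl s sΓ sΔ = identityι A refl s sΓ sΔ

      -- D(ιyA, z, w) is proved by RD with a fresh z′; its first premise
      -- follows by LD₁ from w : A[z/y], the second by LD₂ from w : A[z′/y].
      identityι : ∀ {y s} A → shapeF A ≡ s → ∀ {z w Γ Δ} → SepS B (den (ι y A) z w) →
                  All (SepA B) Γ → All (SepS B) Δ →
                  Deriv N (sf (den (ι y A) z w) ∷ Γ ⇒ den (ι y A) z w ∷ Δ)
      identityι {y} A refl {z} {w} {Γ} {Δ} s sΓ sΔ =
        infer (RD ff ff′ (freshVar-fresh S)) (s ∷ sΓ) (s ∷ sΔ)
          ( infer (LD₁ ff) (s ∷ sΓ) (sAz ∷ sΔ)
              (identityF _ (A [ z / y ]) (shape-subst z y A) sAz (s ∷ sΓ) sΔ ∷ [])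
          ∷ infer (perm swap₂ ↭-refl) (sAz′ ∷ s ∷ sΓ) (sEq ∷ sΔ)
              ( infer (LD₂ ff′) (s ∷ sAz′ ∷ sΓ) (sEq ∷ sΔ)
                  ( infer (perm swap₂ ↭-refl) (s ∷ sAz′ ∷ sΓ) (sAz′ ∷ sEq ∷ sΔ)
                      (identityF _ (A [ z′ / y ]) (shape-subst z′ y A) sAz′ (s ∷ sΓ) (sEq ∷ sΔ) ∷ [])
                  ∷ infer (initAt (atEq z z′)) (sEq ∷ s ∷ sAz′ ∷ sΓ) (sEq ∷ sΔ) []
                  ∷ [])
              ∷ [])
          ∷ [])
        where
        S : Seq
        S = sf (den (ι y A) z w) ∷ Γ ⇒ den (ι y A) z w ∷ Δ
        z′ : Var
        z′ = freshVar S
        z′∉B : z′ ∉ B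
        z′∉B = freshVar∉B S
        z∉B : z ∉ B
        z∉B = All.head (++⁻ʳ (remove y (fvF A)) (proj₁ s))
        sBody : Sep B (remove y (fvF A)) (bvF A)
        sBody = Product.map₁ (++⁻ˡ (remove y (fvF A))) (sep-body s)
        ff : FreeForF z y A
        ff = sep-freeFor A z∉B sBody
        ff′ : FreeForF z′ y A
        ff′ = sep-freeFor A z′∉B sBody
        sAz : SepF B (A [ z / y ])
        sAz = sep-subst A z∉B sBody
        sAz′ : SepF B (A [ z′ / y ])
        sAz′ = sep-subst A z′∉B sBody
        sEq : SepF B (z ≐ z′)
        sEq = z∉B ∷ z′∉B ∷ [] , []

  -- Relative to a bound M on the
  -- variables of an expression, the binder at depth d is renamed to d + M;
  -- ks is the stack of original binder names, innermost first.  The result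
  -- is an alphabetic variant whose free variables stay below M and whose
  -- bound variables are at least M.
  level : ℕ → List Var → Var
  level M ks = length ks + M

  levels : ℕ → List Var → List Var
  levels M []       = []
  levels M (k ∷ ks) = level M ks ∷ levels M ks

  renameV : ℕ → List Var → Var → Var
  renameV M []       v = v
  renameV M (k ∷ ks) v = if ⌊ v ≟ k ⌋ then level M ks else renameV M ks v

  mutual
    renameF : ℕ → List Var → Formula → Formula
    renameF M ks (pr P vs)   = pr P (Vec.map (renameV M ks) vs)
    renameF M ks (a ≐ b)     = renameV M ks a ≐ renameV M ks b
    renameF M ks ⊥'          = ⊥'
    renameF M ks (A ∧' B)    = renameF M ks A ∧' renameF M ks B
    renameF M ks (A ∨' B)    = renameF M ks A ∨' renameF M ks B
    renameF M ks (A ⊃ B)     = renameF M ks A ⊃ renameF M ks B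
    renameF M ks (∀' v A)    = ∀' (level M ks) (renameF M (v ∷ ks) A)
    renameF M ks (∃' v A)    = ∃' (level M ks) (renameF M (v ∷ ks) A)
    renameF M ks (□ A)       = □ (renameF M ks A)
    renameF M ks (◇ A)       = ◇ (renameF M ks A)
    renameF M ks (lam v B t) = lam (level M ks) (renameF M (v ∷ ks) B) (renameT M ks t)

    renameT : ℕ → List Var → Term → Term
    renameT M ks (var v) = var (renameV M ks v)
    renameT M ks (ι v A) = ι (level M ks) (renameF M (v ∷ ks) A)

  mutual
    occF : Formula → List Var
    occF (pr P vs)   = Vec.toList vs
    occF (a ≐ b)     = a ∷ b ∷ []
    occF ⊥'          = []
    occF (A ∧' B)    = occF A ++ occF B
    occF (A ∨' B)    = occF A ++ occF B
    occF (A ⊃ B)     = occF A ++ occF B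
    occF (∀' v A)    = occF A
    occF (∃' v A)    = occF A
    occF (□ A)       = occF A
    occF (◇ A)       = occF A
    occF (lam v B t) = occF B ++ occT t

    occT : Term → List Var
    occT (var v) = [ v ]
    occT (ι v A) = occF A

  module _ {M : ℕ} where

    renameV-< : ∀ ks {u} → u < M → renameV M ks u < level M ks
    renameV-< []       u<M = u<M
    renameV-< (k ∷ ks) {u} u<M with u ≟ k
    ... | yes _ = n<1+n (level M ks)
    ... | no  _ = m<n⇒m<1+n (renameV-< ks u<M)

    renameV-α : ∀ ks {u} → u < M → VarEq ks (levels M ks) u (renameV M ks u)
    renameV-α []       u<M = refl
    renameV-α (k ∷ ks) {u} u<M with u ≟ k
    ... | yes u≡k = inj₁ (u≡k , refl)
    ... | no  u≢k = inj₂ (u≢k , <⇒≢ (renameV-< ks u<M) , renameV-α ks u<M)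

    renameVec-α : ∀ ks {n} (vs : Vec Var n) → All (_< M) (Vec.toList vs) →
                  Pointwise (VarEq ks (levels M ks)) (Vec.toList vs) (Vec.toList (Vec.map (renameV M ks) vs))
    renameVec-α ks Vec.[]       []         = []
    renameVec-α ks (v Vec.∷ vs) (h ∷ hs) = renameV-α ks h ∷ renameVec-α ks vs hs

    renameVec-< : ∀ ks {n} (vs : Vec Var n) → All (_< M) (Vec.toList vs) →
                  All (_< level M ks) (Vec.toList (Vec.map (renameV M ks) vs))
    renameVec-< ks Vec.[]       []         = []
    renameVec-< ks (v Vec.∷ vs) (h ∷ hs) = renameV-< ks h ∷ renameVec-< ks vs hs

    mutual
      renameF-α : ∀ ks A → All (_< M) (occF A) → αF ks (levels M ks) A (renameF M ks A)
      renameF-α ks (pr P vs) h   = refl , renameVec-α ks vs h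
      renameF-α ks (a ≐ b) (ha ∷ hb ∷ []) = renameV-α ks ha , renameV-α ks hb
      renameF-α ks ⊥' h          = tt
      renameF-α ks (A ∧' B) h    = renameF-α ks A (++⁻ˡ _ h) , renameF-α ks B (++⁻ʳ _ h)
      renameF-α ks (A ∨' B) h    = renameF-α ks A (++⁻ˡ _ h) , renameF-α ks B (++⁻ʳ _ h)
      renameF-α ks (A ⊃ B) h     = renameF-α ks A (++⁻ˡ _ h) , renameF-α ks B (++⁻ʳ _ h)
      renameF-α ks (∀' v A) h    = renameF-α (v ∷ ks) A h
      renameF-α ks (∃' v A) h    = renameF-α (v ∷ ks) A h
      renameF-α ks (□ A) h       = renameF-α ks A h
      renameF-α ks (◇ A) h       = renameF-α ks A h
      renameF-α ks (lam v B t) h = renameF-α (v ∷ ks) B (++⁻ˡ _ h) , renameT-α ks t (++⁻ʳ _ h)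

      renameT-α : ∀ ks t → All (_< M) (occT t) → αT ks (levels M ks) t (renameT M ks t)
      renameT-α ks (var v) (h ∷ []) = renameV-α ks h
      renameT-α ks (ι v A) h        = renameF-α (v ∷ ks) A h

    below-remove : ∀ ks L → All (_< suc (level M ks)) L → All (_< level M ks) (remove (level M ks) L)
    below-remove ks L h = All.tabulate λ m →
      let (u∈L , u≢level) = ∈-remove⁻ L m in ≤∧≢⇒< (m<1+n⇒m≤n (All.lookup h u∈L)) u≢level

    mutual
      renameF-fv : ∀ ks A → All (_< M) (occF A) → All (_< level M ks) (fvF (renameF M ks A))
      renameF-fv ks (pr P vs) h   = renameVec-< ks vs h
      renameF-fv ks (a ≐ b) (ha ∷ hb ∷ []) = renameV-< ks ha ∷ renameV-< ks hb ∷ []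
      renameF-fv ks ⊥' h          = []
      renameF-fv ks (A ∧' B) h    = ++⁺ (renameF-fv ks A (++⁻ˡ _ h)) (renameF-fv ks B (++⁻ʳ _ h))
      renameF-fv ks (A ∨' B) h    = ++⁺ (renameF-fv ks A (++⁻ˡ _ h)) (renameF-fv ks B (++⁻ʳ _ h))
      renameF-fv ks (A ⊃ B) h     = ++⁺ (renameF-fv ks A (++⁻ˡ _ h)) (renameF-fv ks B (++⁻ʳ _ h))
      renameF-fv ks (∀' v A) h    = below-remove ks _ (renameF-fv (v ∷ ks) A h)
      renameF-fv ks (∃' v A) h    = below-remove ks _ (renameF-fv (v ∷ ks) A h)
      renameF-fv ks (□ A) h       = renameF-fv ks A h
      renameF-fv ks (◇ A) h       = renameF-fv ks A h
      renameF-fv ks (lam v B t) h =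
        ++⁺ (below-remove ks _ (renameF-fv (v ∷ ks) B (++⁻ˡ _ h))) (renameT-fv ks t (++⁻ʳ _ h))

      renameT-fv : ∀ ks t → All (_< M) (occT t) → All (_< level M ks) (fvT (renameT M ks t))
      renameT-fv ks (var v) (h ∷ []) = renameV-< ks h ∷ []
      renameT-fv ks (ι v A) h        = below-remove ks _ (renameF-fv (v ∷ ks) A h)

    mutual
      renameF-bv : ∀ ks A → All (M ≤_) (bvF (renameF M ks A))
      renameF-bv ks (pr P vs)   = []
      renameF-bv ks (a ≐ b)     = []
      renameF-bv ks ⊥'          = []
      renameF-bv ks (A ∧' B)    = ++⁺ (renameF-bv ks A) (renameF-bv ks B)
      renameF-bv ks (A ∨' B)    = ++⁺ (renameF-bv ks A) (renameF-bv ks B)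
      renameF-bv ks (A ⊃ B)     = ++⁺ (renameF-bv ks A) (renameF-bv ks B)
      renameF-bv ks (∀' v A)    = m≤n+m M (length ks) ∷ renameF-bv (v ∷ ks) A
      renameF-bv ks (∃' v A)    = m≤n+m M (length ks) ∷ renameF-bv (v ∷ ks) A
      renameF-bv ks (□ A)       = renameF-bv ks A
      renameF-bv ks (◇ A)       = renameF-bv ks A
      renameF-bv ks (lam v B t) = m≤n+m M (length ks) ∷ ++⁺ (renameF-bv (v ∷ ks) B) (renameT-bv ks t)

      renameT-bv : ∀ ks t → All (M ≤_) (bvT (renameT M ks t))
      renameT-bv ks (var v) = []
      renameT-bv ks (ι v A) = m≤n+m M (length ks) ∷ renameF-bv (v ∷ ks) A

  renameSF : ℕ → SF → SF
  renameSF M (lab w A)   = lab w (renameF M [] A)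
  renameSF M (den t x w) = den (renameT M [] t) x w

  renameAF : ℕ → AF → AF
  renameAF M (sf e)    = sf (renameSF M e)
  renameAF M (dom x w) = dom x w
  renameAF M (rel w v) = rel w v

  renameS : ℕ → Seq → Seq
  renameS M (Γ ⇒ Δ) = map (renameAF M) Γ ⇒ map (renameSF M) Δ

  occSF : SF → List Var
  occSF (lab w A)   = occF A
  occSF (den t x w) = occT t ++ [ x ]

  occAF : AF → List Var
  occAF (sf e)    = occSF e
  occAF (dom x w) = [ x ]
  occAF (rel w v) = []

  occS : Seq → List Var
  occS (Γ ⇒ Δ) = concatMap occAF Γ ++ concatMap occSF Δ

  module _ {M : ℕ} where

    renameSF-α : ∀ e → All (_< M) (occSF e) → αSF e (renameSF M e)
    renameSF-α (lab w A) h   = refl , renameF-α [] A h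
    renameSF-α (den t x w) h = renameT-α [] t (++⁻ˡ (occT t) h) , refl , refl

    renameAF-α : ∀ a → All (_< M) (occAF a) → αAF a (renameAF M a)
    renameAF-α (sf e) h    = renameSF-α e h
    renameAF-α (dom x w) h = refl , refl
    renameAF-α (rel w v) h = refl , refl

    renameSF-fv : ∀ e → All (_< M) (occSF e) → All (_< M) (fvSF (renameSF M e))
    renameSF-fv (lab w A) h   = renameF-fv [] A h
    renameSF-fv (den t x w) h = ++⁺ (renameT-fv [] t (++⁻ˡ (occT t) h)) (++⁻ʳ (occT t) h)

    renameAF-fv : ∀ a → All (_< M) (occAF a) → All (_< M) (fvAF (renameAF M a))
    renameAF-fv (sf e) h    = renameSF-fv e h
    renameAF-fv (dom x w) h = h
    renameAF-fv (rel w v) h = []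

    renameSF-bv : ∀ e → All (M ≤_) (bvSF (renameSF M e))
    renameSF-bv (lab w A)   = renameF-bv [] A
    renameSF-bv (den t x w) = renameT-bv [] t

    renameAF-bv : ∀ a → All (M ≤_) (bvAF (renameAF M a))
    renameAF-bv (sf e)    = renameSF-bv e
    renameAF-bv (dom x w) = []
    renameAF-bv (rel w v) = []

    renameS-α : ∀ S → All (_< M) (occS S) → AlphaVariant S (renameS M S)
    renameS-α (Γ ⇒ Δ) h =
        pointwise-map Γ renameAF-α (concatMap⁻ Γ (++⁻ˡ _ h))
      , pointwise-map Δ renameSF-α (concatMap⁻ Δ (++⁻ʳ _ h))

    renameS-pure : ∀ S → All (_< M) (occS S) → Pure (renameS M S)
    renameS-pure (Γ ⇒ Δ) h v v∈fv v∈bv = <⇒≱ (All.lookup free v∈fv) (All.lookup bound v∈bv)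
      where
      free : All (_< M) (fvS (renameS M (Γ ⇒ Δ)))
      free = ++⁺ (concatMap⁺ (map⁺ (All.map (λ {a} → renameAF-fv a) (concatMap⁻ Γ (++⁻ˡ _ h)))))
                 (concatMap⁺ (map⁺ (All.map (λ {e} → renameSF-fv e) (concatMap⁻ Δ (++⁻ʳ _ h)))))
      bound : All (M ≤_) (bvS (renameS M (Γ ⇒ Δ)))
      bound = ++⁺ (concatMap⁺ (map⁺ (All.universal renameAF-bv Γ)))
                  (concatMap⁺ (map⁺ (All.universal renameSF-bv Δ)))

  canonical : Seq → Seq
  canonical S = renameS (above (occS S)) S

  derivable-canonical : ∀ {N} S → (Pure (canonical S) → Deriv N (canonical S)) → Derivable N S
  derivable-canonical S d =
    canonical S , renameS-α S (<above (occS S)) , d (renameS-pure S (<above (occS S)))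

  identityF-pure : ∀ N {w A Γ Δ} → Pure (sf (lab w A) ∷ Γ ⇒ lab w A ∷ Δ) →
                   Deriv N (sf (lab w A) ∷ Γ ⇒ lab w A ∷ Δ)
  identityF-pure N {w} {A} {Γ} {Δ} p with pure⇒separated (sf (lab w A) ∷ Γ ⇒ lab w A ∷ Δ) p
  ... | s ∷ sΓ , _ ∷ sΔ = Identities.identityF N _ _ A refl s sΓ sΔ

  identityT-pure : ∀ N {t z w Γ Δ} → Pure (sf (den t z w) ∷ Γ ⇒ den t z w ∷ Δ) →
                   Deriv N (sf (den t z w) ∷ Γ ⇒ den t z w ∷ Δ)
  identityT-pure N {t} {z} {w} {Γ} {Δ} p with pure⇒separated (sf (den t z w) ∷ Γ ⇒ den t z w ∷ Δ) p
  ... | s ∷ sΓ , _ ∷ sΔ = Identities.identityT N _ _ t refl s sΓ sΔ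

mainTheorem7 : {PS : Set} (ar : PS → ℕ) → let open Lang PS ar in
    (N : NL → Set) (A : Formula) (w : Label) (y z : Var) (Γ : List AF) (Δ : List SF) →
    Derivable N (sf (lab w A) ∷ Γ ⇒ lab w A ∷ Δ)
      × Derivable N (sf (den (ι y A) z w) ∷ Γ ⇒ den (ι y A) z w ∷ Δ)
mainTheorem7 ar N A w y z Γ Δ =
  derivable-canonical _ (identityF-pure N) , derivable-canonical _ (identityT-pure N)
  where open GeneralisedIdentity ar
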